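{- Let $s$ be a positive integer. The metric dimension of the generalized quadrangle $\mathrm{GQ}(s,1)$ is $\varphi(s)$, where $\varphi(s)=4r+1$ if $s=3r$, $\varphi(s)=4r+2$ if $s=3r+1$, and $\varphi(s)=4r+3$ if $s=3r+2$ ($r$ a nonnegative integer).
   Context: $\mathrm{GQ}(s,1)$ is the (unique) generalized quadrangle of order $(s,1)$: its points are the pairs $(i,j)$, $1\leq i,j\leq s+1$, and its lines are the $2(s+1)$ "rows" $h_a=\{(i,a): 1\le i\le s+1\}$ and "columns" $v_a=\{(a,i):1\le i\le s+1\}$, with incidence being membership. The metric dimension is the minimum size of a set $S$ of vertices of the incidence graph (bipartite graph on points and lines, adjacency = incidence) such that every two distinct vertices $u\neq v$ have some $x\in S$ with $d(u,x)\neq d(v,x)$. -}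

module Defs where

open import Data.Nat using (ℕ; zero; suc; _+_; _*_; _<_; _≤_)
open import Data.Nat.DivMod using (_/_; _%_)
open import Data.Fin using (Fin)
open import Data.List using (List; length)
open import Data.List.Membership.Propositional using (_∈_)
open import Data.List.Relation.Unary.Unique.Propositional using (Unique)
open import Data.Product using (_×_; ∃-syntax)
open import Relation.Binary.PropositionalEquality using (_≡_; _≢_)
open import Relation.Nullary using (¬_)

-- Vertices of the incidence graph of GQ(s,1), with n = s + 1:
-- points (i , j) and the lines h_a (row a) and v_a (col a).
data Vertex (n : ℕ) : Set where
  point : Fin n → Fin n → Vertex n
  row   : Fin n → Vertex n
  col   : Fin n → Vertex n

data Incident {n : ℕ} : Vertex n → Vertex n → Set where
  pt-row : ∀ i j → Incident (point i j) (row j)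
  pt-col : ∀ i j → Incident (point i j) (col i)

data Adj {n : ℕ} : Vertex n → Vertex n → Set where
  fwd : ∀ {u v} → Incident u v → Adj u v
  bwd : ∀ {u v} → Incident v u → Adj u v

data Walk {n : ℕ} : Vertex n → Vertex n → ℕ → Set where
  here : ∀ {u} → Walk u u zero
  step : ∀ {u w v k} → Adj u w → Walk w v k → Walk u v (suc k)

Dist : {n : ℕ} → Vertex n → Vertex n → ℕ → Set
Dist u v k = Walk u v k × (∀ m → m < k → ¬ Walk u v m)

Resolving : {n : ℕ} → List (Vertex n) → Set
Resolving {n} S =
  (u v : Vertex n) → u ≢ v →
  ∃[ x ] (x ∈ S × ∃[ a ] ∃[ b ] (Dist u x a × Dist v x b × a ≢ b))

MetricDimGQ : (s d : ℕ) → Set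
MetricDimGQ s d =
  (∃[ S ] (Unique S × Resolving {suc s} S × length S ≡ d))
  × (∀ (S : List (Vertex (suc s))) → Resolving S → d ≤ length S)

-- φ(s) = 4r+1, 4r+2, 4r+3 for s = 3r, 3r+1, 3r+2 respectively.
φ : ℕ → ℕ
φ s = 4 * (s / 3) + s % 3 + 1

-- A set S resolves the incidence graph as soon as it contains a line, meets all
-- columns but one, and meets all rows but one "strongly" (each such row lies in S, or carries a
-- point p of S together with a second element of S on the row or on the column of p).  Passing
-- from s to s + 3, the three new rows and columns are handled by the four points (0,0), (0,1),
-- (1,2), (2,2), which gives a resolving set of size φ s.
--
-- Weigh every line by 2 per point of S on it and 4 per copy of it in S, plus 2 if
-- it is a leaf (met by S exactly once, by a point) and 4 if it is unmet.  Every line weighs at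
-- least 4, so summing over the rows and over the columns gives 8n ≤ 4P + 4M + 2L + 4U, where
-- n = s + 1, S has P points and M lines, and there are L leaves and U unmet lines.  A point of S
-- lies on at most one leaf unless it is a double leaf (on a leaf row and a leaf column), so
-- L ≤ P + K with K double leaves.  Resolvability bounds the rest, since otherwise some pair of
-- vertices (two parallel lines, two opposite corners of a rectangle, or a row and a column) is
-- equidistant from all of S; this gives 2K + 4U ≤ 6 + 2M.  Hence 8n ≤ 6|S| + 6, that is |S| ≥ φ s.

module Submission where

open import Defs
open import Data.Bool using (Bool; true; false)
open import Data.Empty using (⊥; ⊥-elim)
open import Data.Fin using (Fin; zero; suc; _↑ʳ_)
open import Data.Fin.Patterns using (0F; 1F; 2F)
open import Data.Fin.Properties using (_≟_; suc-injective)
open import Data.List using (List; []; _∷_; _++_; map; length; lookup; deduplicate)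
open import Data.List.Membership.Propositional using (_∈_)
open import Data.List.Membership.Propositional.Properties using (∈-++⁺ʳ; ∈-map⁺; ∈-deduplicate⁺)
open import Data.List.Properties using (length-map; length-deduplicate)
open import Data.List.Relation.Binary.Subset.Propositional using (_⊆_)
open import Data.List.Relation.Unary.Any using (here; there; index)
open import Data.List.Relation.Unary.Any.Properties using (lookup-index)
open import Data.List.Relation.Unary.Unique.DecPropositional.Properties using (deduplicate-!)
open import Data.Nat using (ℕ; zero; suc; _+_; _*_; _≤_; _<_; z≤n; s≤s; _≤?_)
open import Data.Nat.DivMod using (_/_; _%_; m/n≡1+[m∸n]/n; m≡m%n+[m/n]*n)
open import Data.Nat.Properties
  using ( +-comm; +-identityʳ; *-identityʳ; *-zeroʳ; *-comm; *-assoc; even≢odd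
        ; ≤-refl; ≤-trans; ≤-reflexive; ≤-antisym; <-irrefl; <⇒≱; ≮⇒≥; m<1+n⇒m≤n; m≤m+n; m≤n+m
        ; +-mono-≤; +-monoˡ-≤; +-monoʳ-≤; *-mono-≤; *-monoʳ-≤; *-cancelˡ-≤
        ; +-*-semiring; module ≤-Reasoning)
open import Algebra.Properties.Semiring.Sum +-*-semiring
  using (sum; sum-syntax; sum-cong-≗; sum-replicate-zero; ∑-comm; ∑-distrib-+; *-distribˡ-sum; *-distribʳ-sum)
open import Data.Nat.Tactic.RingSolver using (solve; solve-∀)
open import Data.Product using (_×_; _,_; ∃-syntax)
open import Data.Sum using (_⊎_; inj₁; inj₂; [_,_])
import Data.Sum
open import Function using (_∘_)
open import Relation.Binary.Definitions using (DecidableEquality)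
open import Relation.Binary.PropositionalEquality
  using (_≡_; _≢_; refl; sym; trans; subst; cong; cong₂; ≢-sym; module ≡-Reasoning)
open import Relation.Nullary using (¬_; yes; no; does)
open import Relation.Nullary.Decidable using (dec-true; dec-false; map′; _×-dec_)

private variable
  n : ℕ

-- Distances in the incidence graph

_==_ : Fin n → Fin n → Bool
i == j = does (i ≟ j)

==-refl : (i : Fin n) → (i == i) ≡ true
==-refl i = dec-true (i ≟ i) refl

==-≢ : {i j : Fin n} → i ≢ j → (i == j) ≡ false
==-≢ {i = i} {j} = dec-false (i ≟ j)

mismatch : Bool → ℕ
mismatch true  = 0
mismatch false = 1

dist : Vertex n → Vertex n → ℕ
dist (point i j) (point i′ j′) = 2 * (mismatch (i == i′) + mismatch (j == j′))
dist (point i j) (row b)       = 1 + 2 * mismatch (j == b)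
dist (point i j) (col a)       = 1 + 2 * mismatch (i == a)
dist (row b)     (point i j)   = 1 + 2 * mismatch (b == j)
dist (col a)     (point i j)   = 1 + 2 * mismatch (a == i)
dist (row b)     (row c)       = 4 * mismatch (b == c)
dist (col a)     (col c)       = 4 * mismatch (a == c)
dist (row _)     (col _)       = 2
dist (col _)     (row _)       = 2

dist-refl : (u : Vertex n) → dist u u ≡ 0
dist-refl (point i j) rewrite ==-refl i | ==-refl j = refl
dist-refl (row b)     rewrite ==-refl b = refl
dist-refl (col a)     rewrite ==-refl a = refl

private
  point-flag : ∀ x y → 2 * (mismatch x + mismatch y) ≤ 2 + 2 * mismatch y
  point-flag true  true  = z≤n
  point-flag true  false = s≤s (s≤s z≤n)
  point-flag false true  = ≤-refl
  point-flag false false = ≤-refl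

  flag-point : ∀ x y → 1 + 2 * mismatch y ≤ suc (2 * (mismatch x + mismatch y))
  flag-point _     true  = s≤s z≤n
  flag-point true  false = ≤-refl
  flag-point false false = s≤s (s≤s (s≤s z≤n))

  flag-parallel : ∀ x → 1 + 2 * mismatch x ≤ suc (4 * mismatch x)
  flag-parallel true  = s≤s z≤n
  flag-parallel false = s≤s (s≤s (s≤s z≤n))

  parallel-flag : ∀ x → 4 * mismatch x ≤ 2 + 2 * mismatch x
  parallel-flag true  = z≤n
  parallel-flag false = ≤-refl

  flag≤3 : ∀ x → 1 + 2 * mismatch x ≤ 3
  flag≤3 true  = s≤s z≤n
  flag≤3 false = ≤-refl

  2≤flag+1 : ∀ x → 2 ≤ 2 + 2 * mismatch x
  2≤flag+1 _ = s≤s (s≤s z≤n)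

dist-adj : {u w : Vertex n} → Adj u w → (v : Vertex n) → dist u v ≤ suc (dist w v)
dist-adj (fwd (pt-row i j)) (point i′ j′) = point-flag (i == i′) (j == j′)
dist-adj (fwd (pt-row i j)) (row b)       = flag-parallel (j == b)
dist-adj (fwd (pt-row i j)) (col a)       = flag≤3 (i == a)
dist-adj (fwd (pt-col i j)) (point i′ j′) rewrite +-comm (mismatch (i == i′)) (mismatch (j == j′)) =
  point-flag (j == j′) (i == i′)
dist-adj (fwd (pt-col i j)) (row b)       = flag≤3 (j == b)
dist-adj (fwd (pt-col i j)) (col a)       = flag-parallel (i == a)
dist-adj (bwd (pt-row i j)) (point i′ j′) = flag-point (i == i′) (j == j′)
dist-adj (bwd (pt-row i j)) (row b)       = parallel-flag (j == b)
dist-adj (bwd (pt-row i j)) (col a)       = 2≤flag+1 (i == a)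
dist-adj (bwd (pt-col i j)) (point i′ j′) rewrite +-comm (mismatch (i == i′)) (mismatch (j == j′)) =
  flag-point (j == j′) (i == i′)
dist-adj (bwd (pt-col i j)) (row b)       = 2≤flag+1 (j == b)
dist-adj (bwd (pt-col i j)) (col a)       = parallel-flag (i == a)

dist≤walk : {u v : Vertex n} {m : ℕ} → Walk u v m → dist u v ≤ m
dist≤walk {u = u} here         = ≤-reflexive (dist-refl u)
dist≤walk {v = v} (step uw wv) = ≤-trans (dist-adj uw v) (s≤s (dist≤walk wv))

infixr 5 _▸_
_▸_ : {u w v : Vertex n} {k : ℕ} → Adj u w → Walk w v k → Walk u v (suc k)
_▸_ = step

walk-dist : (u v : Vertex n) → Walk u v (dist u v)
walk-dist (point i j) (point i′ j′) with i ≟ i′ | j ≟ j′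
... | yes refl | yes refl = here
... | yes refl | no _     = fwd (pt-col i j) ▸ bwd (pt-col i j′) ▸ here
... | no _     | yes refl = fwd (pt-row i j) ▸ bwd (pt-row i′ j) ▸ here
... | no _     | no _     =
  fwd (pt-row i j) ▸ bwd (pt-row i′ j) ▸ fwd (pt-col i′ j) ▸ bwd (pt-col i′ j′) ▸ here
walk-dist (point i j) (row b) with j ≟ b
... | yes refl = fwd (pt-row i j) ▸ here
... | no _     = fwd (pt-col i j) ▸ bwd (pt-col i b) ▸ fwd (pt-row i b) ▸ here
walk-dist (point i j) (col a) with i ≟ a
... | yes refl = fwd (pt-col i j) ▸ here
... | no _     = fwd (pt-row i j) ▸ bwd (pt-row a j) ▸ fwd (pt-col a j) ▸ here
walk-dist (row b) (point i j) with b ≟ j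
... | yes refl = bwd (pt-row i b) ▸ here
... | no _     = bwd (pt-row i b) ▸ fwd (pt-col i b) ▸ bwd (pt-col i j) ▸ here
walk-dist (col a) (point i j) with a ≟ i
... | yes refl = bwd (pt-col a j) ▸ here
... | no _     = bwd (pt-col a j) ▸ fwd (pt-row a j) ▸ bwd (pt-row i j) ▸ here
walk-dist (row b) (row c) with b ≟ c
... | yes refl = here
... | no _     = bwd (pt-row c b) ▸ fwd (pt-col c b) ▸ bwd (pt-col c c) ▸ fwd (pt-row c c) ▸ here
walk-dist (col a) (col c) with a ≟ c
... | yes refl = here
... | no _     = bwd (pt-col a a) ▸ fwd (pt-row a a) ▸ bwd (pt-row c a) ▸ fwd (pt-col c a) ▸ here
walk-dist (row b) (col a) = bwd (pt-row a b) ▸ fwd (pt-col a b) ▸ here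
walk-dist (col a) (row b) = bwd (pt-col a b) ▸ fwd (pt-row a b) ▸ here

Dist-dist : (u v : Vertex n) → Dist u v (dist u v)
Dist-dist u v = walk-dist u v , λ m m<d w → <⇒≱ m<d (dist≤walk w)

Dist⇒≡dist : {u v : Vertex n} {k : ℕ} → Dist u v k → k ≡ dist u v
Dist⇒≡dist {u = u} {v} (walk , shortest) =
  ≤-antisym (≮⇒≥ (λ d<k → shortest (dist u v) d<k (walk-dist u v))) (dist≤walk walk)

record Separated (S : List (Vertex n)) (u v : Vertex n) : Set where
  constructor separatedBy
  field
    {witness} : Vertex n
    witness∈S : witness ∈ S
    dist≢     : dist u witness ≢ dist v witness

Resolves : List (Vertex n) → Set
Resolves {n} S = (u v : Vertex n) → u ≢ v → Separated S u v

Separated-sym : {S : List (Vertex n)} {u v : Vertex n} → Separated S u v → Separated S v u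
Separated-sym (separatedBy x∈S d≢) = separatedBy x∈S (≢-sym d≢)

Resolving⇒Resolves : {S : List (Vertex n)} → Resolving S → Resolves S
Resolving⇒Resolves R u v u≢v with R u v u≢v
... | x , x∈S , a , b , Da , Db , a≢b =
  separatedBy x∈S λ eq → a≢b (trans (Dist⇒≡dist Da) (trans eq (sym (Dist⇒≡dist Db))))

Resolves⇒Resolving : {S : List (Vertex n)} → Resolves S → Resolving S
Resolves⇒Resolving R u v u≢v with R u v u≢v
... | separatedBy {x} x∈S d≢ = x , x∈S , dist u x , dist v x , Dist-dist u x , Dist-dist v x , d≢

_≟ᵥ_ : DecidableEquality (Vertex n)
point i j ≟ᵥ point i′ j′ = map′ (λ { (refl , refl) → refl }) (λ { refl → refl , refl }) ((i ≟ i′) ×-dec (j ≟ j′))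
row b     ≟ᵥ row c       = map′ (cong row) (λ { refl → refl }) (b ≟ c)
col a     ≟ᵥ col c       = map′ (cong col) (λ { refl → refl }) (a ≟ c)
point _ _ ≟ᵥ row _       = no (λ ())
point _ _ ≟ᵥ col _       = no (λ ())
row _     ≟ᵥ point _ _   = no (λ ())
row _     ≟ᵥ col _       = no (λ ())
col _     ≟ᵥ point _ _   = no (λ ())
col _     ≟ᵥ row _       = no (λ ())

Resolves-⊆ : {S T : List (Vertex n)} → S ⊆ T → Resolves S → Resolves T
Resolves-⊆ S⊆T resolves u v u≢v with resolves u v u≢v
... | separatedBy x∈S d≢ = separatedBy (S⊆T x∈S) d≢

data Axis : Set where
  horizontal vertical : Axis

line : Axis → Fin n → Vertex n
line horizontal = row
line vertical   = col

line-injective : (ax : Axis) {c c′ : Fin n} → line ax c ≡ line ax c′ → c ≡ c′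
line-injective horizontal refl = refl
line-injective vertical   refl = refl

-- point i j lies on row j and on col i.
coord : Axis → Fin n → Fin n → Fin n
coord horizontal _ j = j
coord vertical   i _ = i

pointAt : Axis → Fin n → Fin n → Vertex n
pointAt horizontal c t = point t c
pointAt vertical   c t = point c t

data IsLine {n : ℕ} : Vertex n → Set where
  isLine : ∀ ax c → IsLine (line ax c)

data Meets {n : ℕ} (ax : Axis) (c : Fin n) : Vertex n → Set where
  itself : Meets ax c (line ax c)
  on     : ∀ {i j} → coord ax i j ≡ c → Meets ax c (point i j)

meets-own-row : {y : Vertex n} {a b : Fin n} → y ≡ point a b → Meets horizontal b y
meets-own-row refl = on refl

meets-own-col : {y : Vertex n} {a b : Fin n} → y ≡ point a b → Meets vertical a y
meets-own-col refl = on refl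

MeetsRectangle : Fin n → Fin n → Fin n → Fin n → Vertex n → Set
MeetsRectangle a a′ b b′ y = Meets horizontal b y ⊎ Meets horizontal b′ y ⊎ Meets vertical a y ⊎ Meets vertical a′ y

private
  odd≢even : ∀ m k → suc (2 * m) ≢ 2 * k
  odd≢even m k eq = even≢odd k m (sym eq)

  odd≢quadruple : ∀ m k → suc (2 * m) ≢ 4 * k
  odd≢quadruple m k eq = odd≢even m (2 * k) (trans eq (*-assoc 2 2 k))

  quadruple≢2 : ∀ x → 4 * mismatch x ≢ 2
  quadruple≢2 true  ()
  quadruple≢2 false ()

point≢line : (i j : Fin n) {ℓ : Vertex n} → IsLine ℓ → (x : Vertex n) → dist (point i j) x ≢ dist ℓ x
point≢line i j (isLine horizontal c) (point i′ j′) = even≢odd (mismatch (i == i′) + mismatch (j == j′)) (mismatch (c == j′))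
point≢line i j (isLine vertical   c) (point i′ j′) = even≢odd (mismatch (i == i′) + mismatch (j == j′)) (mismatch (c == i′))
point≢line i j (isLine horizontal c) (row b)       = odd≢quadruple (mismatch (j == b)) (mismatch (c == b))
point≢line i j (isLine horizontal c) (col a)       = odd≢even (mismatch (i == a)) 1
point≢line i j (isLine vertical   c) (row b)       = odd≢even (mismatch (j == b)) 1
point≢line i j (isLine vertical   c) (col a)       = odd≢quadruple (mismatch (i == a)) (mismatch (c == a))

row≢col : (b a : Fin n) {x : Vertex n} → IsLine x → dist (row b) x ≢ dist (col a) x
row≢col b a (isLine horizontal c) = quadruple≢2 (b == c)
row≢col b a (isLine vertical   c) = ≢-sym (quadruple≢2 (a == c))

lines-separated : {ax : Axis} {c c′ : Fin n} {y : Vertex n} → c ≢ c′ → Meets ax c y →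
                  dist (line ax c) y ≢ dist (line ax c′) y
lines-separated {ax = horizontal} {c} c≢c′ itself  rewrite ==-refl c | ==-≢ (≢-sym c≢c′) = λ ()
lines-separated {ax = vertical}   {c} c≢c′ itself  rewrite ==-refl c | ==-≢ (≢-sym c≢c′) = λ ()
lines-separated {ax = horizontal} {c} c≢c′ (on refl) rewrite ==-refl c | ==-≢ (≢-sym c≢c′) = λ ()
lines-separated {ax = vertical}   {c} c≢c′ (on refl) rewrite ==-refl c | ==-≢ (≢-sym c≢c′) = λ ()

points-separated : {ax : Axis} {c c′ : Fin n} (t : Fin n) {y : Vertex n} → c ≢ c′ → Meets ax c y →
                   dist (pointAt ax c t) y ≢ dist (pointAt ax c′ t) y
points-separated {ax = horizontal} {c} t c≢c′ itself rewrite ==-refl c | ==-≢ (≢-sym c≢c′) = λ ()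
points-separated {ax = vertical}   {c} t c≢c′ itself rewrite ==-refl c | ==-≢ (≢-sym c≢c′) = λ ()
points-separated {ax = horizontal} {c} t {point i _} c≢c′ (on refl)
  rewrite ==-refl c | ==-≢ (≢-sym c≢c′) with t == i
... | true  = λ ()
... | false = λ ()
points-separated {ax = vertical}   {c} t {point _ j} c≢c′ (on refl)
  rewrite ==-refl c | ==-≢ (≢-sym c≢c′) with t == j
... | true  = λ ()
... | false = λ ()

lines-equidistant : {ax : Axis} {c c′ : Fin n} (z : Vertex n) → ¬ Meets ax c z → ¬ Meets ax c′ z →
                    dist (line ax c) z ≡ dist (line ax c′) z
lines-equidistant {ax = horizontal} (point i j) ¬m ¬m′
  rewrite ==-≢ (λ c≡j → ¬m (on (sym c≡j))) | ==-≢ (λ c′≡j → ¬m′ (on (sym c′≡j))) = refl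
lines-equidistant {ax = vertical}   (point i j) ¬m ¬m′
  rewrite ==-≢ (λ c≡i → ¬m (on (sym c≡i))) | ==-≢ (λ c′≡i → ¬m′ (on (sym c′≡i))) = refl
lines-equidistant {ax = horizontal} {c} {c′} (row b) ¬m ¬m′
  rewrite ==-≢ {i = c} {b} (λ { refl → ¬m itself }) | ==-≢ {i = c′} {b} (λ { refl → ¬m′ itself }) = refl
lines-equidistant {ax = vertical}   {c} {c′} (col a) ¬m ¬m′
  rewrite ==-≢ {i = c} {a} (λ { refl → ¬m itself }) | ==-≢ {i = c′} {a} (λ { refl → ¬m′ itself }) = refl
lines-equidistant {ax = horizontal} (col _) _ _ = refl
lines-equidistant {ax = vertical}   (row _) _ _ = refl

row-col-equidistant : {a b : Fin n} (z : Vertex n) → ¬ IsLine z →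
                      (Meets horizontal b z ⊎ Meets vertical a z → z ≡ point a b) →
                      dist (row b) z ≡ dist (col a) z
row-col-equidistant (row c) ¬line _ = ⊥-elim (¬line (isLine horizontal c))
row-col-equidistant (col c) ¬line _ = ⊥-elim (¬line (isLine vertical c))
row-col-equidistant {a = a} {b} (point i j) _ corner with b ≟ j
... | yes refl with corner (inj₁ (on refl))
...   | refl rewrite ==-refl a = refl
row-col-equidistant {a = a} {b} (point i j) _ corner | no b≢j with a ≟ i
... | yes refl with corner (inj₂ (on refl))
...   | refl = ⊥-elim (b≢j refl)
row-col-equidistant {a = a} {b} (point i j) _ corner | no b≢j | no a≢i = refl

opposite-corners-equidistant : {a a′ b b′ : Fin n} → a ≢ a′ → b ≢ b′ → (z : Vertex n) →
                               (MeetsRectangle a a′ b b′ z → z ≡ point a b ⊎ z ≡ point a′ b′) →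
                               dist (point a b′) z ≡ dist (point a′ b) z
opposite-corners-equidistant {a = a} {a′} {b} {b′} a≢a′ b≢b′ = equidistant
  where
  at-corner : ∀ {z} → z ≡ point a b ⊎ z ≡ point a′ b′ → dist (point a b′) z ≡ dist (point a′ b) z
  at-corner (inj₁ refl) rewrite ==-refl a  | ==-refl b  | ==-≢ (≢-sym b≢b′) | ==-≢ (≢-sym a≢a′) = refl
  at-corner (inj₂ refl) rewrite ==-refl a′ | ==-refl b′ | ==-≢ a≢a′ | ==-≢ b≢b′ = refl

  not-a-corner : ∀ {x} → IsLine x → ¬ (x ≡ point a b ⊎ x ≡ point a′ b′)
  not-a-corner (isLine horizontal _) = [ (λ ()) , (λ ()) ]
  not-a-corner (isLine vertical   _) = [ (λ ()) , (λ ()) ]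

  equidistant : ∀ z → (MeetsRectangle a a′ b b′ z → z ≡ point a b ⊎ z ≡ point a′ b′) →
                dist (point a b′) z ≡ dist (point a′ b) z
  equidistant (point c f) corner with f ≟ b | f ≟ b′ | c ≟ a | c ≟ a′
  ... | yes refl | _        | _        | _        = at-corner (corner (inj₁ (on refl)))
  ... | no _     | yes refl | _        | _        = at-corner (corner (inj₂ (inj₁ (on refl))))
  ... | no _     | no _     | yes refl | _        = at-corner (corner (inj₂ (inj₂ (inj₁ (on refl)))))
  ... | no _     | no _     | no _     | yes refl = at-corner (corner (inj₂ (inj₂ (inj₂ (on refl)))))
  ... | no f≢b   | no f≢b′  | no c≢a   | no c≢a′
    rewrite ==-≢ (≢-sym c≢a) | ==-≢ (≢-sym f≢b′) | ==-≢ (≢-sym c≢a′) | ==-≢ (≢-sym f≢b) = refl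
  equidistant (row r) corner with r ≟ b | r ≟ b′
  ... | yes refl | _        = ⊥-elim (not-a-corner (isLine horizontal r) (corner (inj₁ itself)))
  ... | no _     | yes refl = ⊥-elim (not-a-corner (isLine horizontal r) (corner (inj₂ (inj₁ itself))))
  ... | no r≢b   | no r≢b′  rewrite ==-≢ (≢-sym r≢b′) | ==-≢ (≢-sym r≢b) = refl
  equidistant (col r) corner with r ≟ a | r ≟ a′
  ... | yes refl | _        = ⊥-elim (not-a-corner (isLine vertical r) (corner (inj₂ (inj₂ (inj₁ itself)))))
  ... | no _     | yes refl = ⊥-elim (not-a-corner (isLine vertical r) (corner (inj₂ (inj₂ (inj₂ itself)))))
  ... | no r≢a   | no r≢a′  rewrite ==-≢ (≢-sym r≢a) | ==-≢ (≢-sym r≢a′) = refl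

-- A resolving set of size φ s

Met : Axis → Fin n → List (Vertex n) → Set
Met ax c S = ∃[ y ] (y ∈ S × Meets ax c y)

StronglyMet : List (Vertex n) → Fin n → Set
StronglyMet S b =
  row b ∈ S ⊎
  ∃[ a ] (point a b ∈ S × ∃[ y ] (y ∈ S × y ≢ point a b × (Meets horizontal b y ⊎ Meets vertical a y)))

StronglyMet⇒Met : {S : List (Vertex n)} {b : Fin n} → StronglyMet S b → Met horizontal b S
StronglyMet⇒Met (inj₁ row∈S)             = row _ , row∈S , itself
StronglyMet⇒Met (inj₂ (_ , point∈S , _)) = point _ _ , point∈S , on refl

record Spread (S : List (Vertex n)) : Set where
  field
    someLine        : ∃[ ℓ ] (ℓ ∈ S × IsLine ℓ)
    spareRow        : Fin n
    rowsStronglyMet : ∀ b → b ≢ spareRow → StronglyMet S b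
    spareCol        : Fin n
    colsMet         : ∀ a → a ≢ spareCol → Met vertical a S

separated-by-met : {S : List (Vertex n)} {ax : Axis} {c* c c′ : Fin n} (f : Fin n → Vertex n) →
                   (∀ {c c′ y} → c ≢ c′ → Meets ax c y → dist (f c) y ≢ dist (f c′) y) →
                   (∀ c → c ≢ c* → Met ax c S) → c ≢ c′ → Separated S (f c) (f c′)
separated-by-met {c* = c*} {c} f separates met c≢c′ with c ≟ c*
... | no c≢c* with met c c≢c*
...   | y , y∈S , meets = separatedBy y∈S (separates c≢c′ meets)
separated-by-met {c* = c*} {c} {c′} f separates met c≢c′ | yes refl with met c′ (≢-sym c≢c′)
...   | y , y∈S , meets = separatedBy y∈S (≢-sym (separates (≢-sym c≢c′) meets))

private
  row-separates : {i i′ j j′ : Fin n} → j ≢ j′ → dist (point i j) (row j) ≢ dist (point i′ j′) (row j)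
  row-separates {j = j} j≢j′ rewrite ==-refl j | ==-≢ (≢-sym j≢j′) = λ ()

  cell-separates : {i i′ j j′ a : Fin n} → j ≢ j′ → a ≢ i′ →
                   dist (point i j) (point a j) ≢ dist (point i′ j′) (point a j)
  cell-separates {i = i} {j = j} {a = a} j≢j′ a≢i′
    rewrite ==-refl j | ==-≢ (≢-sym j≢j′) | ==-≢ (≢-sym a≢i′) with i == a
  ... | true  = λ ()
  ... | false = λ ()

strongly-met-separates : {S : List (Vertex n)} {i i′ j j′ : Fin n} → i ≢ i′ → j ≢ j′ → StronglyMet S j →
                         Separated S (point i j) (point i′ j′)
strongly-met-separates {i = i} {i′} _ j≢j′ (inj₁ row∈S) = separatedBy row∈S (row-separates {i = i} {i′} j≢j′)
strongly-met-separates {i = i} {i′} {j} {j′} i≢i′ j≢j′ (inj₂ (a , a∈S , y , y∈S , y≢a , meets)) with a ≟ i′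
... | no a≢i′   = separatedBy a∈S (cell-separates {i = i} j≢j′ a≢i′)
... | yes refl = separatedBy y∈S (separates meets y≢a)
  where
  separates : ∀ {y} → Meets horizontal j y ⊎ Meets vertical i′ y → y ≢ point i′ j →
              dist (point i j) y ≢ dist (point i′ j′) y
  separates (inj₁ itself)                 _   = row-separates {i = i} {i′} j≢j′
  separates (inj₁ (on refl))              y≢a = cell-separates {i = i} {i′} j≢j′ (λ { refl → y≢a refl })
  separates (inj₂ itself)                 _   rewrite ==-refl i′ | ==-≢ i≢i′ = λ ()
  separates (inj₂ (on {j = c} refl)) y≢a
    rewrite ==-refl i′ | ==-≢ i≢i′ | ==-≢ (λ (j≡c : j ≡ c) → y≢a (cong (point i′) (sym j≡c))) with j′ == c
  ... | true  = λ ()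
  ... | false = λ ()

Spread⇒Resolves : {S : List (Vertex n)} → Spread S → Resolves S
Spread⇒Resolves {S = S} spread = separate
  where
  open Spread spread

  rowsMet : ∀ b → b ≢ spareRow → Met horizontal b S
  rowsMet b b≢ = StronglyMet⇒Met (rowsStronglyMet b b≢)

  point-line : ∀ i j {ℓ} → IsLine ℓ → Separated S (point i j) ℓ
  point-line i j isL with someLine
  ... | x , x∈S , _ = separatedBy x∈S (point≢line i j isL x)

  row-col : ∀ b a → Separated S (row b) (col a)
  row-col b a with someLine
  ... | _ , x∈S , isL = separatedBy x∈S (row≢col b a isL)

  separate : Resolves S
  separate (point i j) (point i′ j′) p≢p′ with i ≟ i′ | j ≟ j′
  ... | yes refl | yes refl = ⊥-elim (p≢p′ refl)
  ... | yes refl | no j≢j′  = separated-by-met (λ c → pointAt horizontal c i) (points-separated i) rowsMet j≢j′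
  ... | no i≢i′  | yes refl = separated-by-met (λ c → pointAt vertical c j) (points-separated j) colsMet i≢i′
  ... | no i≢i′  | no j≢j′ with j ≟ spareRow
  ...   | no j≢*   = strongly-met-separates i≢i′ j≢j′ (rowsStronglyMet j j≢*)
  ...   | yes refl = Separated-sym (strongly-met-separates (≢-sym i≢i′) (≢-sym j≢j′) (rowsStronglyMet j′ (≢-sym j≢j′)))
  separate (point i j) (row b)   _ = point-line i j (isLine horizontal b)
  separate (point i j) (col a)   _ = point-line i j (isLine vertical a)
  separate (row b)   (point i j) _ = Separated-sym (point-line i j (isLine horizontal b))
  separate (col a)   (point i j) _ = Separated-sym (point-line i j (isLine vertical a))
  separate (row b) (row b′) r≢r′ = separated-by-met row lines-separated rowsMet (λ { refl → r≢r′ refl })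
  separate (col a) (col a′) c≢c′ = separated-by-met col lines-separated colsMet (λ { refl → c≢c′ refl })
  separate (row b) (col a) _ = row-col b a
  separate (col a) (row b) _ = Separated-sym (row-col b a)

shift : {m : ℕ} → Vertex m → Vertex (3 + m)
shift (point i j) = point (3 ↑ʳ i) (3 ↑ʳ j)
shift (row b)     = row (3 ↑ʳ b)
shift (col a)     = col (3 ↑ʳ a)

shift-injective : {m : ℕ} {x y : Vertex m} → shift x ≡ shift y → x ≡ y
shift-injective {x = point _ _} {point _ _} refl = refl
shift-injective {x = row _}     {row _}     refl = refl
shift-injective {x = col _}     {col _}     refl = refl

Meets-shift : {m : ℕ} {ax : Axis} {c : Fin m} {y : Vertex m} → Meets ax c y → Meets ax (3 ↑ʳ c) (shift y)
Meets-shift {ax = horizontal} itself   = itself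
Meets-shift {ax = vertical}   itself   = itself
Meets-shift {ax = horizontal} (on refl) = on refl
Meets-shift {ax = vertical}   (on refl) = on refl

IsLine-shift : {m : ℕ} {y : Vertex m} → IsLine y → IsLine (shift y)
IsLine-shift (isLine horizontal c) = isLine horizontal _
IsLine-shift (isLine vertical   c) = isLine vertical _

block : {m : ℕ} → List (Vertex (3 + m))
block = point 0F 0F ∷ point 0F 1F ∷ point 1F 2F ∷ point 2F 2F ∷ []

extend : {m : ℕ} → List (Vertex m) → List (Vertex (3 + m))
extend S = block ++ map shift S

∈-extend : {m : ℕ} {S : List (Vertex m)} {x : Vertex m} → x ∈ S → shift x ∈ extend S
∈-extend x∈S = ∈-++⁺ʳ block (∈-map⁺ shift x∈S)

StronglyMet-extend : {m : ℕ} {S : List (Vertex m)} {b : Fin m} → StronglyMet S b → StronglyMet (extend S) (3 ↑ʳ b)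
StronglyMet-extend (inj₁ row∈S) = inj₁ (∈-extend row∈S)
StronglyMet-extend (inj₂ (a , a∈S , y , y∈S , y≢a , meets)) =
  inj₂ (3 ↑ʳ a , ∈-extend a∈S , shift y , ∈-extend y∈S , (λ eq → y≢a (shift-injective eq)) ,
        Data.Sum.map Meets-shift Meets-shift meets)

Spread-extend : {m : ℕ} {S : List (Vertex m)} → Spread S → Spread (extend S)
Spread-extend {S = S} spread = record
  { someLine        = let ℓ , ℓ∈S , isL = someLine in shift ℓ , ∈-extend ℓ∈S , IsLine-shift isL
  ; spareRow        = 3 ↑ʳ spareRow
  ; rowsStronglyMet = rows
  ; spareCol        = 3 ↑ʳ spareCol
  ; colsMet         = cols
  }
  where
  open Spread spread
  rows : ∀ b → b ≢ 3 ↑ʳ spareRow → StronglyMet (extend S) b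
  rows 0F _ = inj₂ (0F , here refl , point 0F 1F , there (here refl) , (λ ()) , inj₂ (on refl))
  rows 1F _ = inj₂ (0F , there (here refl) , point 0F 0F , here refl , (λ ()) , inj₂ (on refl))
  rows 2F _ = inj₂ (1F , there (there (here refl)) , point 2F 2F , there (there (there (here refl))) , (λ ()) , inj₁ (on refl))
  rows (suc (suc (suc b))) b≢ = StronglyMet-extend (rowsStronglyMet b (λ { refl → b≢ refl }))
  cols : ∀ a → a ≢ 3 ↑ʳ spareCol → Met vertical a (extend S)
  cols 0F _ = point 0F 0F , here refl , on refl
  cols 1F _ = point 1F 2F , there (there (here refl)) , on refl
  cols 2F _ = point 2F 2F , there (there (there (here refl))) , on refl
  cols (suc (suc (suc a))) a≢ with colsMet a (λ { refl → a≢ refl })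
  ... | y , y∈S , meets = shift y , ∈-extend y∈S , Meets-shift meets

resolvingList : (s : ℕ) → List (Vertex (suc s))
resolvingList 0 = row 0F ∷ []
resolvingList 1 = point 0F 0F ∷ row 1F ∷ []
resolvingList 2 = point 0F 0F ∷ point 0F 1F ∷ col 1F ∷ []
resolvingList (suc (suc (suc s))) = extend (resolvingList s)

Spread-resolvingList : (s : ℕ) → Spread (resolvingList s)
Spread-resolvingList 0 = record
  { someLine = row 0F , here refl , isLine horizontal 0F
  ; spareRow = 0F ; rowsStronglyMet = λ { 0F 0≢0 → ⊥-elim (0≢0 refl) }
  ; spareCol = 0F ; colsMet         = λ { 0F 0≢0 → ⊥-elim (0≢0 refl) }
  }
Spread-resolvingList 1 = record
  { someLine = row 1F , there (here refl) , isLine horizontal 1F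
  ; spareRow = 0F ; rowsStronglyMet = λ { 0F 0≢0 → ⊥-elim (0≢0 refl) ; 1F _ → inj₁ (there (here refl)) }
  ; spareCol = 1F ; colsMet         = λ { 0F _ → point 0F 0F , here refl , on refl ; 1F 1≢1 → ⊥-elim (1≢1 refl) }
  }
Spread-resolvingList 2 = record
  { someLine = col 1F , there (there (here refl)) , isLine vertical 1F
  ; spareRow = 2F
  ; rowsStronglyMet = λ
      { 0F _ → inj₂ (0F , here refl , point 0F 1F , there (here refl) , (λ ()) , inj₂ (on refl))
      ; 1F _ → inj₂ (0F , there (here refl) , point 0F 0F , here refl , (λ ()) , inj₂ (on refl))
      ; 2F 2≢2 → ⊥-elim (2≢2 refl)
      }
  ; spareCol = 2F
  ; colsMet = λ
      { 0F _ → point 0F 0F , here refl , on refl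
      ; 1F _ → col 1F , there (there (here refl)) , itself
      ; 2F 2≢2 → ⊥-elim (2≢2 refl)
      }
  }
Spread-resolvingList (suc (suc (suc s))) = Spread-extend (Spread-resolvingList s)

φ-step : ∀ s → φ (3 + s) ≡ 4 + φ s
φ-step s rewrite m/n≡1+[m∸n]/n {3 + s} {3} (s≤s (s≤s (s≤s z≤n))) = solve-step (s / 3) (s % 3)
  where
  solve-step : ∀ q r → 4 * suc q + r + 1 ≡ 4 + (4 * q + r + 1)
  solve-step = solve-∀

length-resolvingList : (s : ℕ) → length (resolvingList s) ≡ φ s
length-resolvingList 0 = refl
length-resolvingList 1 = refl
length-resolvingList 2 = refl
length-resolvingList (suc (suc (suc s))) = begin
  length (block ++ map shift (resolvingList s)) ≡⟨ cong (4 +_) (length-map shift (resolvingList s)) ⟩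
  4 + length (resolvingList s)                  ≡⟨ cong (4 +_) (length-resolvingList s) ⟩
  4 + φ s                                       ≡⟨ sym (φ-step s) ⟩
  φ (3 + s)                                     ∎
  where open ≡-Reasoning

∑-mono-≤ : {f g : Fin n → ℕ} → (∀ i → f i ≤ g i) → sum f ≤ sum g
∑-mono-≤ {zero}  f≤g = z≤n
∑-mono-≤ {suc n} f≤g = +-mono-≤ (f≤g zero) (∑-mono-≤ (f≤g ∘ suc))

∑-const : ∀ n k → ∑[ i < n ] k ≡ n * k
∑-const zero    k = refl
∑-const (suc n) k = cong (k +_) (∑-const n k)

term≤∑ : (f : Fin n → ℕ) (i : Fin n) → f i ≤ sum f
term≤∑ f zero    = m≤m+n (f zero) _
term≤∑ f (suc i) = ≤-trans (term≤∑ (f ∘ suc) i) (m≤n+m _ (f zero))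

pair≤∑ : (f : Fin n → ℕ) {i j : Fin n} → i ≢ j → f i + f j ≤ sum f
pair≤∑ f {zero}  {zero}  0≢0 = ⊥-elim (0≢0 refl)
pair≤∑ f {zero}  {suc j} _   = +-monoʳ-≤ (f zero) (term≤∑ (f ∘ suc) j)
pair≤∑ f {suc i} {zero}  _   = ≤-trans (≤-reflexive (+-comm (f (suc i)) (f zero)))
                                       (+-monoʳ-≤ (f zero) (term≤∑ (f ∘ suc) i))
pair≤∑ f {suc i} {suc j} i≢j = ≤-trans (pair≤∑ (f ∘ suc) (i≢j ∘ cong suc)) (m≤n+m _ (f zero))

∑-positive : (f : Fin n → ℕ) → 1 ≤ sum f → ∃[ i ] 1 ≤ f i
∑-positive {suc n} f 1≤∑ with 1 ≤? f zero
... | yes 1≤f0 = zero , 1≤f0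
... | no  1≰f0 with ∑-positive (f ∘ suc) (≤-trans 1≤∑ (+-monoˡ-≤ _ (≮⇒≥ 1≰f0)))
...   | i , 1≤fi = suc i , 1≤fi

∑≤1 : (f : Fin n → ℕ) → (∀ i → f i ≤ 1) → (∀ {i j} → i ≢ j → 1 ≤ f i → 1 ≤ f j → ⊥) → sum f ≤ 1
∑≤1 {zero}  f f≤1 exclusive = z≤n
∑≤1 {suc n} f f≤1 exclusive with 1 ≤? f zero
... | yes 1≤f0 = +-mono-≤ (f≤1 zero) (≤-trans (∑-mono-≤ rest≤0) (≤-reflexive (sum-replicate-zero n)))
  where
  rest≤0 : ∀ i → f (suc i) ≤ 0
  rest≤0 i = ≮⇒≥ (exclusive (λ ()) 1≤f0)
... | no  1≰f0 = +-mono-≤ (≮⇒≥ 1≰f0) (∑≤1 (f ∘ suc) (f≤1 ∘ suc) (λ i≢j → exclusive (i≢j ∘ suc-injective)))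

term≤∑-+ : (f g : Fin n → ℕ) (i : Fin n) → f i + g i ≤ sum f + sum g
term≤∑-+ f g i = ≤-trans (term≤∑ (λ i → f i + g i) i) (≤-reflexive (∑-distrib-+ f g))

double-count : ∀ {m} (f : Fin m → Fin n → ℕ) (g : Fin m → ℕ) →
               (∀ k → ∑[ c < n ] f k c ≡ g k) → ∑[ c < n ] ∑[ k < m ] f k c ≡ ∑[ k < m ] g k
double-count f g rows = trans (sym (∑-comm f)) (sum-cong-≗ rows)

∑-+-scaled : (f : Fin n → ℕ) (a : ℕ) (g : Fin n → ℕ) → ∑[ i < n ] (f i + a * g i) ≡ sum f + a * sum g
∑-+-scaled f a g = trans (∑-distrib-+ f ((a *_) ∘ g)) (cong (sum f +_) (sym (*-distribˡ-sum a g)))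

indicator : Bool → ℕ
indicator true  = 1
indicator false = 0

∑-select : (x : Fin n) (h : Fin n → ℕ) → ∑[ c < n ] (indicator (x == c) * h c) ≡ h x
∑-select {suc n} zero    h = begin
  h zero + 0 + ∑[ c < n ] 0 ≡⟨ cong₂ _+_ (+-identityʳ (h zero)) (sum-replicate-zero n) ⟩
  h zero + 0               ≡⟨ +-identityʳ (h zero) ⟩
  h zero                   ∎
  where open ≡-Reasoning
∑-select {suc n} (suc x) h = ∑-select x (h ∘ suc)

∑-indicator : (x : Fin n) → ∑[ c < n ] indicator (x == c) ≡ 1
∑-indicator x = trans (sum-cong-≗ (λ c → sym (*-identityʳ (indicator (x == c))))) (∑-select x (λ _ → 1))

-- Counting the lines met by a set of vertices

pointOn : Axis → Fin n → Vertex n → ℕ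
pointOn ax c (point i j) = indicator (coord ax i j == c)
pointOn _  _ _           = 0

lineAt : Axis → Fin n → Vertex n → ℕ
lineAt horizontal c (row b) = indicator (b == c)
lineAt vertical   c (col a) = indicator (a == c)
lineAt _          _ _       = 0

isPoint : Vertex n → ℕ
isPoint (point _ _) = 1
isPoint _           = 0

isLineAlong : Axis → Vertex n → ℕ
isLineAlong horizontal (row _) = 1
isLineAlong vertical   (col _) = 1
isLineAlong _          _       = 0

1≡isPoint+isLineAlong : (y : Vertex n) → 1 ≡ isPoint y + isLineAlong horizontal y + isLineAlong vertical y
1≡isPoint+isLineAlong (point _ _) = refl
1≡isPoint+isLineAlong (row _)     = refl
1≡isPoint+isLineAlong (col _)     = refl

atLineThrough : Axis → (Fin n → ℕ) → Vertex n → ℕ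
atLineThrough ax h (point i j) = h (coord ax i j)
atLineThrough _  _ _           = 0

∑-pointOn : (ax : Axis) (y : Vertex n) → ∑[ c < n ] pointOn ax c y ≡ isPoint y
∑-pointOn {n} ax (point i j) = ∑-indicator (coord ax i j)
∑-pointOn {n} ax (row _)     = sum-replicate-zero n
∑-pointOn {n} ax (col _)     = sum-replicate-zero n

∑-lineAt : (ax : Axis) (y : Vertex n) → ∑[ c < n ] lineAt ax c y ≡ isLineAlong ax y
∑-lineAt {n} horizontal (point _ _) = sum-replicate-zero n
∑-lineAt {n} horizontal (row b)     = ∑-indicator b
∑-lineAt {n} horizontal (col _)     = sum-replicate-zero n
∑-lineAt {n} vertical   (point _ _) = sum-replicate-zero n
∑-lineAt {n} vertical   (row _)     = sum-replicate-zero n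
∑-lineAt {n} vertical   (col a)     = ∑-indicator a

∑-pointOn-weighted : (ax : Axis) (h : Fin n → ℕ) (y : Vertex n) →
                     ∑[ c < n ] (pointOn ax c y * h c) ≡ atLineThrough ax h y
∑-pointOn-weighted {n} ax h (point i j) = ∑-select (coord ax i j) h
∑-pointOn-weighted {n} ax h (row _)     = sum-replicate-zero n
∑-pointOn-weighted {n} ax h (col _)     = sum-replicate-zero n

Meets⇒counted : {ax : Axis} {c : Fin n} {y : Vertex n} → Meets ax c y → 1 ≤ pointOn ax c y + lineAt ax c y
Meets⇒counted {ax = horizontal} {c} itself    rewrite ==-refl c = ≤-refl
Meets⇒counted {ax = vertical}   {c} itself    rewrite ==-refl c = ≤-refl
Meets⇒counted {ax = horizontal} {c} (on refl) rewrite ==-refl c = s≤s z≤n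
Meets⇒counted {ax = vertical}   {c} (on refl) rewrite ==-refl c = s≤s z≤n

-- For a line with d points of S on it and μ copies of it in S.
isLeaf : ℕ → ℕ → ℕ
isLeaf 1 0 = 1
isLeaf _ _ = 0

isUnmet : ℕ → ℕ → ℕ
isUnmet 0 0 = 1
isUnmet _ _ = 0

isLeaf≤1 : ∀ d μ → isLeaf d μ ≤ 1
isLeaf≤1 0             _       = z≤n
isLeaf≤1 1             0       = ≤-refl
isLeaf≤1 1             (suc _) = z≤n
isLeaf≤1 (suc (suc _)) _       = z≤n

isUnmet≤1 : ∀ d μ → isUnmet d μ ≤ 1
isUnmet≤1 0       0       = ≤-refl
isUnmet≤1 0       (suc _) = z≤n
isUnmet≤1 (suc _) _       = z≤n

isLeaf≡d*isLeaf : ∀ d μ → isLeaf d μ ≡ d * isLeaf d μ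
isLeaf≡d*isLeaf 0             _       = refl
isLeaf≡d*isLeaf 1             0       = refl
isLeaf≡d*isLeaf 1             (suc _) = refl
isLeaf≡d*isLeaf (suc (suc d)) _       = sym (*-zeroʳ (suc (suc d)))

isLeaf⇒d+μ≡1 : ∀ d μ → 1 ≤ isLeaf d μ → d + μ ≡ 1
isLeaf⇒d+μ≡1 1 0 _ = refl
isLeaf⇒d+μ≡1 0             _       ()
isLeaf⇒d+μ≡1 1             (suc _) ()
isLeaf⇒d+μ≡1 (suc (suc _)) _       ()

isUnmet⇒d+μ≡0 : ∀ d μ → 1 ≤ isUnmet d μ → d + μ ≡ 0
isUnmet⇒d+μ≡0 0       0       _ = refl
isUnmet⇒d+μ≡0 0       (suc _) ()
isUnmet⇒d+μ≡0 (suc _) _       ()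

private
  a+b≤1+a*b : ∀ a b → a ≤ 1 → b ≤ 1 → a + b ≤ 1 + a * b
  a+b≤1+a*b 0             b             _        b≤1      = b≤1
  a+b≤1+a*b 1             0             _        _        = ≤-refl
  a+b≤1+a*b 1             1             _        _        = ≤-refl
  a+b≤1+a*b 1             (suc (suc _)) _        (s≤s ())
  a+b≤1+a*b (suc (suc _)) _             (s≤s ()) _

  1≤*⇒ : ∀ p q → 1 ≤ p * q → 1 ≤ p × 1 ≤ q
  1≤*⇒ (suc p) (suc q) _     = s≤s z≤n , s≤s z≤n
  1≤*⇒ 0       _       ()
  1≤*⇒ (suc p) 0       1≤p*0 with subst (1 ≤_) (*-zeroʳ p) 1≤p*0
  ... | ()

  ≤-padded : ∀ {a b} x y → a ≤ b → a ≤ b + x + y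
  ≤-padded {b = b} x y a≤b = ≤-trans a≤b (≤-trans (m≤m+n b x) (m≤m+n _ y))

line-weight : ∀ d μ → 4 ≤ 2 * d + 4 * μ + 2 * isLeaf d μ + 4 * isUnmet d μ
line-weight 0             0       = ≤-refl
line-weight 1             0       = ≤-refl
line-weight (suc (suc d)) 0       = ≤-padded 0 0 (≤-trans (*-monoʳ-≤ 2 (m≤m+n 2 d)) (m≤m+n _ 0))
line-weight d             (suc μ) = ≤-padded _ _ (≤-trans (*-monoʳ-≤ 4 (s≤s z≤n)) (m≤n+m (4 * suc μ) (2 * d)))

excess-bound : ∀ K U V M → K ≤ 1 → U ≤ 1 → V ≤ 1 → (1 ≤ K → 1 ≤ U → 1 ≤ V → ⊥) →
               (M ≡ 0 → 1 ≤ K → ⊥) → (M ≡ 0 → 1 ≤ U → 1 ≤ V → ⊥) → 2 * K + 4 * (U + V) ≤ 6 + 2 * M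
excess-bound (suc (suc _)) _ _ _ (s≤s ()) _ _ _ _ _
excess-bound _ (suc (suc _)) _ _ _ (s≤s ()) _ _ _ _
excess-bound _ _ (suc (suc _)) _ _ _ (s≤s ()) _ _ _
excess-bound 1 1 1 _       _ _ _ notAll _   _    = ⊥-elim (notAll ≤-refl ≤-refl ≤-refl)
excess-bound 1 _ _ 0       _ _ _ _      noK _    = ⊥-elim (noK refl ≤-refl)
excess-bound 0 1 1 0       _ _ _ _      _   noUV = ⊥-elim (noUV refl ≤-refl ≤-refl)
excess-bound 0 0 0 M       _ _ _ _      _   _    = z≤n
excess-bound 0 1 0 M       _ _ _ _      _   _    = ≤-trans (s≤s (s≤s (s≤s (s≤s z≤n)))) (m≤m+n 6 (2 * M))
excess-bound 0 0 1 M       _ _ _ _      _   _    = ≤-trans (s≤s (s≤s (s≤s (s≤s z≤n)))) (m≤m+n 6 (2 * M))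
excess-bound 0 1 1 (suc M) _ _ _ _      _   _    = +-monoʳ-≤ 6 (*-monoʳ-≤ 2 (s≤s (z≤n {M})))
excess-bound 1 0 0 (suc M) _ _ _ _      _   _    = ≤-trans (s≤s (s≤s z≤n)) (m≤m+n 6 (2 * suc M))
excess-bound 1 1 0 (suc M) _ _ _ _      _   _    = m≤m+n 6 (2 * suc M)
excess-bound 1 0 1 (suc M) _ _ _ _      _   _    = m≤m+n 6 (2 * suc M)

counting-bound : ∀ n m P Mₕ Mᵥ Lₕ Lᵥ Uₕ Uᵥ K →
                 4 * n ≤ 2 * P + 4 * Mₕ + 2 * Lₕ + 4 * Uₕ →
                 4 * n ≤ 2 * P + 4 * Mᵥ + 2 * Lᵥ + 4 * Uᵥ →
                 Lₕ + Lᵥ ≤ P + K →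
                 2 * K + 4 * (Uₕ + Uᵥ) ≤ 6 + 2 * (Mₕ + Mᵥ) →
                 m ≡ P + Mₕ + Mᵥ →
                 4 * n ≤ 3 * m + 3
counting-bound n m P Mₕ Mᵥ Lₕ Lᵥ Uₕ Uᵥ K rows cols leaves excess refl = *-cancelˡ-≤ 2 (begin
  2 * (4 * n)                                                          ≡⟨ solve (n ∷ []) ⟩
  4 * n + 4 * n                                                        ≤⟨ +-mono-≤ rows cols ⟩
  2 * P + 4 * Mₕ + 2 * Lₕ + 4 * Uₕ + (2 * P + 4 * Mᵥ + 2 * Lᵥ + 4 * Uᵥ)
    ≡⟨ solve (P ∷ Mₕ ∷ Mᵥ ∷ Lₕ ∷ Lᵥ ∷ Uₕ ∷ Uᵥ ∷ []) ⟩
  4 * P + 4 * (Mₕ + Mᵥ) + 4 * (Uₕ + Uᵥ) + 2 * (Lₕ + Lᵥ)                ≤⟨ +-monoʳ-≤ (4 * P + 4 * (Mₕ + Mᵥ) + 4 * (Uₕ + Uᵥ)) (*-monoʳ-≤ 2 leaves) ⟩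
  4 * P + 4 * (Mₕ + Mᵥ) + 4 * (Uₕ + Uᵥ) + 2 * (P + K)                  ≡⟨ solve (P ∷ Mₕ ∷ Mᵥ ∷ Uₕ ∷ Uᵥ ∷ K ∷ []) ⟩
  6 * P + 4 * (Mₕ + Mᵥ) + (2 * K + 4 * (Uₕ + Uᵥ))                      ≤⟨ +-monoʳ-≤ (6 * P + 4 * (Mₕ + Mᵥ)) excess ⟩
  6 * P + 4 * (Mₕ + Mᵥ) + (6 + 2 * (Mₕ + Mᵥ))                          ≡⟨ solve (P ∷ Mₕ ∷ Mᵥ ∷ []) ⟩
  2 * (3 * (P + Mₕ + Mᵥ) + 3)                                          ∎)
  where open ≤-Reasoning

module Census {m : ℕ} (σ : Fin m → Vertex n) where

  pointsOn : Axis → Fin n → ℕ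
  pointsOn ax c = ∑[ k < m ] pointOn ax c (σ k)

  copiesOf : Axis → Fin n → ℕ
  copiesOf ax c = ∑[ k < m ] lineAt ax c (σ k)

  leaf : Axis → Fin n → ℕ
  leaf ax c = isLeaf (pointsOn ax c) (copiesOf ax c)

  unmet : Axis → Fin n → ℕ
  unmet ax c = isUnmet (pointsOn ax c) (copiesOf ax c)

  doubleLeaf : Vertex n → ℕ
  doubleLeaf (point i j) = leaf horizontal j * leaf vertical i
  doubleLeaf _           = 0

  #points #doubleLeaves : ℕ
  #points       = ∑[ k < m ] isPoint (σ k)
  #doubleLeaves = ∑[ k < m ] doubleLeaf (σ k)

  #lines #leaves #unmet : Axis → ℕ
  #lines  ax = ∑[ k < m ] isLineAlong ax (σ k)
  #leaves ax = ∑[ c < n ] leaf ax c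
  #unmet  ax = ∑[ c < n ] unmet ax c

  m≡#points+#lines : m ≡ #points + #lines horizontal + #lines vertical
  m≡#points+#lines = begin
    m                 ≡⟨ sym (*-identityʳ m) ⟩
    m * 1             ≡⟨ sym (∑-const m 1) ⟩
    ∑[ k < m ] 1      ≡⟨ sum-cong-≗ (1≡isPoint+isLineAlong ∘ σ) ⟩
    ∑[ k < m ] (isPoint (σ k) + isLineAlong horizontal (σ k) + isLineAlong vertical (σ k))
                      ≡⟨ ∑-distrib-+ (λ k → isPoint (σ k) + isLineAlong horizontal (σ k)) _ ⟩
    ∑[ k < m ] (isPoint (σ k) + isLineAlong horizontal (σ k)) + #lines vertical
                      ≡⟨ cong (_+ #lines vertical) (∑-distrib-+ (isPoint ∘ σ) _) ⟩
    #points + #lines horizontal + #lines vertical ∎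
    where open ≡-Reasoning

  ∑-pointsOn : ∀ ax → ∑[ c < n ] pointsOn ax c ≡ #points
  ∑-pointsOn ax = double-count (λ k c → pointOn ax c (σ k)) (isPoint ∘ σ) (∑-pointOn ax ∘ σ)

  ∑-copiesOf : ∀ ax → ∑[ c < n ] copiesOf ax c ≡ #lines ax
  ∑-copiesOf ax = double-count (λ k c → lineAt ax c (σ k)) (isLineAlong ax ∘ σ) (∑-lineAt ax ∘ σ)

  #leaves≡ : ∀ ax → #leaves ax ≡ ∑[ k < m ] atLineThrough ax (leaf ax) (σ k)
  #leaves≡ ax = begin
    ∑[ c < n ] leaf ax c                                    ≡⟨ sum-cong-≗ (λ c → isLeaf≡d*isLeaf (pointsOn ax c) (copiesOf ax c)) ⟩
    ∑[ c < n ] (pointsOn ax c * leaf ax c)                  ≡⟨ sum-cong-≗ (λ c → *-distribʳ-sum (leaf ax c) (λ k → pointOn ax c (σ k))) ⟩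
    ∑[ c < n ] ∑[ k < m ] (pointOn ax c (σ k) * leaf ax c) ≡⟨ double-count (λ k c → pointOn ax c (σ k) * leaf ax c) _ (∑-pointOn-weighted ax (leaf ax) ∘ σ) ⟩
    ∑[ k < m ] atLineThrough ax (leaf ax) (σ k)             ∎
    where open ≡-Reasoning

  #leaves≤#points+#doubleLeaves : #leaves horizontal + #leaves vertical ≤ #points + #doubleLeaves
  #leaves≤#points+#doubleLeaves = begin
    #leaves horizontal + #leaves vertical
      ≡⟨ cong₂ _+_ (#leaves≡ horizontal) (#leaves≡ vertical) ⟩
    ∑[ k < m ] atLineThrough horizontal (leaf horizontal) (σ k) + ∑[ k < m ] atLineThrough vertical (leaf vertical) (σ k)
      ≡⟨ sym (∑-distrib-+ (atLineThrough horizontal (leaf horizontal) ∘ σ) (atLineThrough vertical (leaf vertical) ∘ σ)) ⟩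
    ∑[ k < m ] (atLineThrough horizontal (leaf horizontal) (σ k) + atLineThrough vertical (leaf vertical) (σ k))
      ≤⟨ ∑-mono-≤ (pointwise ∘ σ) ⟩
    ∑[ k < m ] (isPoint (σ k) + doubleLeaf (σ k))
      ≡⟨ ∑-distrib-+ (isPoint ∘ σ) (doubleLeaf ∘ σ) ⟩
    #points + #doubleLeaves ∎
    where
    open ≤-Reasoning
    pointwise : ∀ y → atLineThrough horizontal (leaf horizontal) y + atLineThrough vertical (leaf vertical) y ≤ isPoint y + doubleLeaf y
    pointwise (point i j) = a+b≤1+a*b (leaf horizontal j) (leaf vertical i) (isLeaf≤1 _ _) (isLeaf≤1 _ _)
    pointwise (row _)     = z≤n
    pointwise (col _)     = z≤n

  line-bound : ∀ ax → 4 * n ≤ 2 * #points + 4 * #lines ax + 2 * #leaves ax + 4 * #unmet ax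
  line-bound ax = begin
    4 * n          ≡⟨ *-comm 4 n ⟩
    n * 4          ≡⟨ sym (∑-const n 4) ⟩
    ∑[ c < n ] 4   ≤⟨ ∑-mono-≤ (λ c → line-weight (pointsOn ax c) (copiesOf ax c)) ⟩
    ∑[ c < n ] (2 * pointsOn ax c + 4 * copiesOf ax c + 2 * leaf ax c + 4 * unmet ax c)
      ≡⟨ ∑-+-scaled _ 4 (unmet ax) ⟩
    ∑[ c < n ] (2 * pointsOn ax c + 4 * copiesOf ax c + 2 * leaf ax c) + 4 * #unmet ax
      ≡⟨ cong (_+ 4 * #unmet ax) (∑-+-scaled _ 2 (leaf ax)) ⟩
    ∑[ c < n ] (2 * pointsOn ax c + 4 * copiesOf ax c) + 2 * #leaves ax + 4 * #unmet ax
      ≡⟨ cong (λ t → t + 2 * #leaves ax + 4 * #unmet ax) (∑-+-scaled _ 4 (copiesOf ax)) ⟩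
    ∑[ c < n ] (2 * pointsOn ax c) + 4 * ∑[ c < n ] copiesOf ax c + 2 * #leaves ax + 4 * #unmet ax
      ≡⟨ cong (λ t → t + 4 * ∑[ c < n ] copiesOf ax c + 2 * #leaves ax + 4 * #unmet ax) (sym (*-distribˡ-sum 2 (pointsOn ax))) ⟩
    2 * ∑[ c < n ] pointsOn ax c + 4 * ∑[ c < n ] copiesOf ax c + 2 * #leaves ax + 4 * #unmet ax
      ≡⟨ cong₂ (λ p l → 2 * p + 4 * l + 2 * #leaves ax + 4 * #unmet ax) (∑-pointsOn ax) (∑-copiesOf ax) ⟩
    2 * #points + 4 * #lines ax + 2 * #leaves ax + 4 * #unmet ax ∎
    where open ≤-Reasoning

  Meets⇒1≤pointsOn+copiesOf : {ax : Axis} {c : Fin n} {k : Fin m} → Meets ax c (σ k) → 1 ≤ pointsOn ax c + copiesOf ax c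
  Meets⇒1≤pointsOn+copiesOf {ax} {c} {k} meets =
    ≤-trans (Meets⇒counted meets) (term≤∑-+ (pointOn ax c ∘ σ) (lineAt ax c ∘ σ) k)

  unmet⇒¬Meets : {ax : Axis} {c : Fin n} → 1 ≤ unmet ax c → ∀ k → ¬ Meets ax c (σ k)
  unmet⇒¬Meets {ax} {c} u k meets with subst (1 ≤_) (isUnmet⇒d+μ≡0 (pointsOn ax c) (copiesOf ax c) u) (Meets⇒1≤pointsOn+copiesOf meets)
  ... | ()

  leaf⇒unique : {ax : Axis} {c : Fin n} → 1 ≤ leaf ax c → ∀ {k k′} → Meets ax c (σ k) → Meets ax c (σ k′) → k ≡ k′
  leaf⇒unique {ax} {c} ℓ {k} {k′} meets meets′ with k ≟ k′
  ... | yes k≡k′ = k≡k′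
  ... | no  k≢k′ = ⊥-elim (<-irrefl refl (begin-strict
    1                                                           <⟨ +-mono-≤ (Meets⇒counted meets) (Meets⇒counted meets′) ⟩
    pointOn ax c (σ k) + lineAt ax c (σ k) + (pointOn ax c (σ k′) + lineAt ax c (σ k′))
                                                                ≤⟨ pair≤∑ (λ k → pointOn ax c (σ k) + lineAt ax c (σ k)) k≢k′ ⟩
    ∑[ k < m ] (pointOn ax c (σ k) + lineAt ax c (σ k))         ≡⟨ ∑-distrib-+ (pointOn ax c ∘ σ) (lineAt ax c ∘ σ) ⟩
    pointsOn ax c + copiesOf ax c                               ≡⟨ isLeaf⇒d+μ≡1 (pointsOn ax c) (copiesOf ax c) ℓ ⟩
    1                                                           ∎))
    where open ≤-Reasoning

  DoubleLeafAt : Vertex n → Fin n → Fin n → Set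
  DoubleLeafAt y a b = y ≡ point a b × 1 ≤ leaf horizontal b × 1 ≤ leaf vertical a

  doubleLeaf≤1 : ∀ y → doubleLeaf y ≤ 1
  doubleLeaf≤1 (point i j) = *-mono-≤ (isLeaf≤1 (pointsOn horizontal j) (copiesOf horizontal j)) (isLeaf≤1 (pointsOn vertical i) (copiesOf vertical i))
  doubleLeaf≤1 (row _)     = z≤n
  doubleLeaf≤1 (col _)     = z≤n

  doubleLeaf⇒ : ∀ y → 1 ≤ doubleLeaf y → ∃[ a ] ∃[ b ] DoubleLeafAt y a b
  doubleLeaf⇒ (point a b) d = a , b , refl , 1≤*⇒ (leaf horizontal b) (leaf vertical a) d

  isolated : ∀ {k a b} → DoubleLeafAt (σ k) a b →
             ∀ {k′} → Meets horizontal b (σ k′) ⊎ Meets vertical a (σ k′) → σ k′ ≡ point a b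
  isolated (σk≡ab , ℓb , _) (inj₁ meets) = trans (cong σ (leaf⇒unique ℓb meets (meets-own-row σk≡ab))) σk≡ab
  isolated (σk≡ab , _ , ℓa) (inj₂ meets) = trans (cong σ (leaf⇒unique ℓa meets (meets-own-col σk≡ab))) σk≡ab

  IsLine⇒counted : {y : Vertex n} → IsLine y → 1 ≤ isLineAlong horizontal y + isLineAlong vertical y
  IsLine⇒counted (isLine horizontal _) = s≤s z≤n
  IsLine⇒counted (isLine vertical   _) = s≤s z≤n

  no-lines⇒¬IsLine : #lines horizontal + #lines vertical ≡ 0 → ∀ k → ¬ IsLine (σ k)
  no-lines⇒¬IsLine none k isL
    with subst (1 ≤_) none (≤-trans (IsLine⇒counted isL) (term≤∑-+ (isLineAlong horizontal ∘ σ) (isLineAlong vertical ∘ σ) k))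
  ... | ()

  module Resolved (resolves : ∀ {u v : Vertex n} → u ≢ v → ∃[ k ] dist u (σ k) ≢ dist v (σ k)) where

    ¬equidistant : {u v : Vertex n} → u ≢ v → ¬ (∀ k → dist u (σ k) ≡ dist v (σ k))
    ¬equidistant u≢v same with resolves u≢v
    ... | k , differ = differ (same k)

    ¬isolated-corners : ∀ {a a′ b b′} → a ≢ a′ → b ≢ b′ →
                        ¬ (∀ k → MeetsRectangle a a′ b b′ (σ k) → σ k ≡ point a b ⊎ σ k ≡ point a′ b′)
    ¬isolated-corners {a} {a′} {b} {b′} a≢a′ b≢b′ corner =
      ¬equidistant {point a b′} {point a′ b} (λ { refl → a≢a′ refl })
                   (λ k → opposite-corners-equidistant a≢a′ b≢b′ (σ k) (corner k))

    #unmet≤1 : ∀ ax → #unmet ax ≤ 1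
    #unmet≤1 ax = ∑≤1 (unmet ax) (λ c → isUnmet≤1 (pointsOn ax c) (copiesOf ax c)) λ c≢c′ u u′ →
      ¬equidistant (c≢c′ ∘ line-injective ax)
                         (λ k → lines-equidistant (σ k) (unmet⇒¬Meets u k) (unmet⇒¬Meets u′ k))

    #doubleLeaves≤1 : #doubleLeaves ≤ 1
    #doubleLeaves≤1 = ∑≤1 (doubleLeaf ∘ σ) (doubleLeaf≤1 ∘ σ) two-absurd
      where
      two-absurd : ∀ {k k′} → k ≢ k′ → 1 ≤ doubleLeaf (σ k) → 1 ≤ doubleLeaf (σ k′) → ⊥
      two-absurd {k} {k′} k≢k′ d d′ with doubleLeaf⇒ (σ k) d | doubleLeaf⇒ (σ k′) d′
      ... | a , b , dl@(σk≡ab , ℓb , ℓa) | a′ , b′ , dl′@(σk′≡a′b′ , ℓb′ , ℓa′) = ¬isolated-corners a≢a′ b≢b′ corner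
        where
        b≢b′ : b ≢ b′
        b≢b′ refl = k≢k′ (leaf⇒unique ℓb (meets-own-row σk≡ab) (meets-own-row σk′≡a′b′))
        a≢a′ : a ≢ a′
        a≢a′ refl = k≢k′ (leaf⇒unique ℓa (meets-own-col σk≡ab) (meets-own-col σk′≡a′b′))
        corner : ∀ k″ → MeetsRectangle a a′ b b′ (σ k″) → σ k″ ≡ point a b ⊎ σ k″ ≡ point a′ b′
        corner k″ (inj₁ meets)                     = inj₁ (isolated dl (inj₁ meets))
        corner k″ (inj₂ (inj₁ meets))              = inj₂ (isolated dl′ (inj₁ meets))
        corner k″ (inj₂ (inj₂ (inj₁ meets)))       = inj₁ (isolated dl (inj₂ meets))
        corner k″ (inj₂ (inj₂ (inj₂ meets)))       = inj₂ (isolated dl′ (inj₂ meets))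

    ¬doubleLeaf-unmet-unmet : 1 ≤ #doubleLeaves → 1 ≤ #unmet horizontal → 1 ≤ #unmet vertical → ⊥
    ¬doubleLeaf-unmet-unmet d u u′ with ∑-positive (doubleLeaf ∘ σ) d | ∑-positive (unmet horizontal) u | ∑-positive (unmet vertical) u′
    ... | k , dk | b′ , ub′ | a′ , ua′ with doubleLeaf⇒ (σ k) dk
    ...   | a , b , dl@(σk≡ab , _ , _) = ¬isolated-corners a≢a′ b≢b′ corner
      where
      b≢b′ : b ≢ b′
      b≢b′ refl = unmet⇒¬Meets ub′ k (meets-own-row σk≡ab)
      a≢a′ : a ≢ a′
      a≢a′ refl = unmet⇒¬Meets ua′ k (meets-own-col σk≡ab)
      corner : ∀ k″ → MeetsRectangle a a′ b b′ (σ k″) → σ k″ ≡ point a b ⊎ σ k″ ≡ point a′ b′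
      corner k″ (inj₁ meets)               = inj₁ (isolated dl (inj₁ meets))
      corner k″ (inj₂ (inj₁ meets))        = ⊥-elim (unmet⇒¬Meets ub′ k″ meets)
      corner k″ (inj₂ (inj₂ (inj₁ meets))) = inj₁ (isolated dl (inj₂ meets))
      corner k″ (inj₂ (inj₂ (inj₂ meets))) = ⊥-elim (unmet⇒¬Meets ua′ k″ meets)

    no-lines⇒¬doubleLeaf : #lines horizontal + #lines vertical ≡ 0 → 1 ≤ #doubleLeaves → ⊥
    no-lines⇒¬doubleLeaf none d with ∑-positive (doubleLeaf ∘ σ) d
    ... | k , dk with doubleLeaf⇒ (σ k) dk
    ...   | a , b , dl =
      ¬equidistant {row b} {col a} (λ ()) (λ k′ → row-col-equidistant (σ k′) (no-lines⇒¬IsLine none k′) (isolated dl))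

    no-lines⇒¬unmet-unmet : #lines horizontal + #lines vertical ≡ 0 → 1 ≤ #unmet horizontal → 1 ≤ #unmet vertical → ⊥
    no-lines⇒¬unmet-unmet none u u′ with ∑-positive (unmet horizontal) u | ∑-positive (unmet vertical) u′
    ... | b , ub | a , ua =
      ¬equidistant {row b} {col a} (λ ()) (λ k → row-col-equidistant (σ k) (no-lines⇒¬IsLine none k) (corner k))
      where
      corner : ∀ k → Meets horizontal b (σ k) ⊎ Meets vertical a (σ k) → σ k ≡ point a b
      corner k (inj₁ meets) = ⊥-elim (unmet⇒¬Meets ub k meets)
      corner k (inj₂ meets) = ⊥-elim (unmet⇒¬Meets ua k meets)

    lower-bound : 4 * n ≤ 3 * m + 3
    lower-bound = counting-bound n m #points (#lines horizontal) (#lines vertical)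
      (#leaves horizontal) (#leaves vertical) (#unmet horizontal) (#unmet vertical) #doubleLeaves
      (line-bound horizontal) (line-bound vertical) #leaves≤#points+#doubleLeaves
      (excess-bound #doubleLeaves (#unmet horizontal) (#unmet vertical) (#lines horizontal + #lines vertical)
        #doubleLeaves≤1 (#unmet≤1 horizontal) (#unmet≤1 vertical) ¬doubleLeaf-unmet-unmet
        no-lines⇒¬doubleLeaf no-lines⇒¬unmet-unmet)
      m≡#points+#lines

Resolves⇒lookup : {S : List (Vertex n)} → Resolves S →
                  ∀ {u v} → u ≢ v → ∃[ k ] dist u (lookup S k) ≢ dist v (lookup S k)
Resolves⇒lookup resolves {u} {v} u≢v with resolves u v u≢v
... | separatedBy x∈S d≢ = index x∈S , subst (λ x → dist u x ≢ dist v x) (lookup-index x∈S) d≢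

Resolves⇒4n≤3|S|+3 : (S : List (Vertex n)) → Resolves S → 4 * n ≤ 3 * length S + 3
Resolves⇒4n≤3|S|+3 S = Census.Resolved.lower-bound (lookup S) ∘ Resolves⇒lookup

private
  quotient-bound : ∀ q r L → 4 * suc (r + q * 3) ≤ 3 * L + 3 → 4 * q + r + 1 ≤ L
  quotient-bound q r L bound = ≮⇒≥ (λ L<φ → <⇒≱ (too-small L<φ) bound)
    where
    open ≤-Reasoning
    too-small : L < 4 * q + r + 1 → 3 * L + 3 < 4 * suc (r + q * 3)
    too-small L<φ = begin-strict
      3 * L + 3                      ≤⟨ +-monoˡ-≤ 3 (*-monoʳ-≤ 3 (m<1+n⇒m≤n (subst (L <_) (+-comm (4 * q + r) 1) L<φ))) ⟩
      3 * (4 * q + r) + 3            <⟨ s≤s (m≤m+n _ r) ⟩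
      suc (3 * (4 * q + r) + 3 + r)  ≡⟨ solve (q ∷ r ∷ []) ⟩
      4 * suc (r + q * 3)            ∎

φ-lower : ∀ s L → 4 * suc s ≤ 3 * L + 3 → φ s ≤ L
φ-lower s L = quotient-bound (s / 3) (s % 3) L ∘ subst (λ t → 4 * suc t ≤ 3 * L + 3) (m≡m%n+[m/n]*n s 3)

mainTheorem7 : (s : ℕ) → 1 ≤ s → MetricDimGQ s (φ s)
mainTheorem7 s _ = (S , deduplicate-! _≟ᵥ_ (resolvingList s) , resolving , ≤-antisym |S|≤φ (lower S resolving)) , lower
  where
  lower : ∀ T → Resolving T → φ s ≤ length T
  lower T = φ-lower s (length T) ∘ Resolves⇒4n≤3|S|+3 T ∘ Resolving⇒Resolves

  S : List (Vertex (suc s))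
  S = deduplicate _≟ᵥ_ (resolvingList s)

  resolving : Resolving S
  resolving = Resolves⇒Resolving (Resolves-⊆ (∈-deduplicate⁺ _≟ᵥ_) (Spread⇒Resolves (Spread-resolvingList s)))

  |S|≤φ : length S ≤ φ s
  |S|≤φ = ≤-trans (length-deduplicate _≟ᵥ_ (resolvingList s)) (≤-reflexive (length-resolvingList s))
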